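{- Let $r,k$ be coprime with $1\le k<r/3$ and $\{0,k\}\subseteq A\subseteq[0,k]\subseteq\mathbb{Z}/r\mathbb{Z}$. Let $J_+,J_-\subseteq\mathbb{Z}/r\mathbb{Z}$ and $u\in\mathbb{Z}/r\mathbb{Z}\setminus(J_+\cup J_-)$, and suppose $\Gamma_0=\{P_w\}_{w\in J_+}\cup\{\lnot P_{w_0}\}_{w_0\in J_- }$ is consistent. Then $\Gamma_0\sqcup\{\lnot P_u\}$ is inconsistent if and only if $A+u\subseteq\bigcup_{w\in J_+}(A+w)$.
   Context: $[a,b]=\{\overline a,\dots,\overline b\}\subseteq\mathbb{Z}/r\mathbb{Z}$ for integers $a\le b$; $A+w=\{a+w\mid a\in A\}$. For a valuation $V\subseteq\mathbb{Z}/r\mathbb{Z}$, $P_w$ is true iff $A+w\subseteq V$, and $\lnot P_w$ is its negation. A set of such propositions is consistent if some valuation $V\subseteq\mathbb{Z}/r\mathbb{Z}$ makes all of them true. -}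

module Defs where

open import Data.Nat using (ℕ; _+_; _≤_; NonZero)
open import Data.Nat.DivMod using (_mod_)
open import Data.Fin using (Fin; toℕ)
open import Data.Fin.Subset using (Subset; _∈_; _∉_)
open import Data.Product using (Σ; ∃; _×_; _,_)
open import Relation.Binary.PropositionalEquality using (_≡_)
open import Relation.Nullary using (¬_)

-- ℤ/rℤ is modelled by Fin r; the class of an integer j ≥ 0 is j mod r.
[_]ᵣ : ∀ {r} .{{_ : NonZero r}} → ℕ → Fin r
[_]ᵣ {r} j = j mod r

_⊕_ : ∀ {r} .{{_ : NonZero r}} → Fin r → Fin r → Fin r
_⊕_ {r} a b = (toℕ a + toℕ b) mod r

_∈[0,_] : ∀ {r} .{{_ : NonZero r}} → Fin r → ℕ → Set
_∈[0,_] {r} x k = Σ ℕ λ j → j ≤ k × x ≡ [ j ]ᵣ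

_∈+_[_] : ∀ {r} .{{_ : NonZero r}} → Fin r → Fin r → Subset r → Set
x ∈+ w [ A ] = Σ (Fin _) λ a → a ∈ A × x ≡ a ⊕ w

-- the proposition P_w evaluated at a valuation V : A + w ⊆ V
P : ∀ {r} .{{_ : NonZero r}} → Subset r → Fin r → Subset r → Set
P A w V = ∀ x → x ∈+ w [ A ] → x ∈ V

Sat : ∀ {r} .{{_ : NonZero r}} → Subset r → Subset r → Subset r → Subset r → Set
Sat A J₊ J₋ V = (∀ w → w ∈ J₊ → P A w V) × (∀ w → w ∈ J₋ → ¬ P A w V)

Consistent : ∀ {r} .{{_ : NonZero r}} → Subset r → Subset r → Subset r → Set
Consistent {r} A J₊ J₋ = Σ (Subset r) λ V → Sat A J₊ J₋ V

ConsistentWith¬ : ∀ {r} .{{_ : NonZero r}} → Subset r → Subset r → Subset r → Fin r → Set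
ConsistentWith¬ {r} A J₊ J₋ u = Σ (Subset r) λ V → Sat A J₊ J₋ V × ¬ P A u V

-- Every valuation satisfying the P_w with w ∈ J₊ contains C = ⋃_{w ∈ J₊} (A + w), and C itself
-- satisfies them. Since P_w is monotone in the valuation, a negative literal ¬P_w that holds at
-- some model of Γ₀ also holds at the smaller model C. So Γ₀ ⊔ {¬P_u} is consistent iff C
-- satisfies ¬P_u, i.e. iff A + u ⊈ C.
module Submission where

open import Defs
open import Level using (Level)
open import Data.Nat using (ℕ; _≤_; _<_; _*_; NonZero)
open import Data.Nat.Coprimality using (Coprime)
open import Data.Empty using (⊥-elim)
open import Data.Bool.Properties using (T-≡)
open import Data.Fin using (Fin)
open import Data.Fin.Properties using (any?; _≟_)
open import Data.Fin.Subset using (Subset; _∈_; _∉_; _⊆_)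
open import Data.Fin.Subset.Properties using (_∈?_)
open import Data.Vec using (tabulate)
open import Data.Vec.Properties using (lookup∘tabulate; []=⇒lookup; lookup⇒[]=)
open import Data.Product using (Σ; _×_; _,_)
open import Function using (_∘_)
open import Function.Bundles using (_⇔_; mk⇔; Equivalence)
open import Relation.Binary.PropositionalEquality using (trans; sym)
open import Relation.Nullary using (¬_)
open import Relation.Nullary.Decidable using (yes; no; isYes; _×-dec_; toWitness; fromWitness)
open import Relation.Unary using (Pred; Decidable)

module _ {ℓ : Level} {n : ℕ} {Q : Pred (Fin n) ℓ} (Q? : Decidable Q) where

  subset : Subset n
  subset = tabulate (isYes ∘ Q?)

  ∈subset⇔ : ∀ {x} → x ∈ subset ⇔ Q x
  ∈subset⇔ {x} = mk⇔
    (λ x∈ → toWitness (Equivalence.from T-≡ (trans (sym (lookup∘tabulate _ x)) ([]=⇒lookup x∈))))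
    (λ qx → lookup⇒[]= x subset (trans (lookup∘tabulate _ x) (Equivalence.to T-≡ (fromWitness qx))))

module _ {r : ℕ} .{{_ : NonZero r}} (A : Subset r) where

  P-mono : ∀ {V W} w → V ⊆ W → P A w V → P A w W
  P-mono w V⊆W p x x∈ = V⊆W (p x x∈)

  module _ (J : Subset r) where

    Covered : Fin r → Set
    Covered y = Σ (Fin r) λ w → w ∈ J × y ∈+ w [ A ]

    covered? : Decidable Covered
    covered? y = any? λ w → (w ∈? J) ×-dec any? λ a → (a ∈? A) ×-dec (y ≟ a ⊕ w)

    cover : Subset r
    cover = subset covered?

    ∈cover⇔ : ∀ {y} → y ∈ cover ⇔ Covered y
    ∈cover⇔ = ∈subset⇔ covered?

    P-cover : ∀ w → w ∈ J → P A w cover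
    P-cover w w∈J y y∈ = Equivalence.from ∈cover⇔ (w , w∈J , y∈)

    covered⇒∈ : ∀ {V} → (∀ w → w ∈ J → P A w V) → ∀ {y} → Covered y → y ∈ V
    covered⇒∈ sat (w , w∈J , y∈) = sat w w∈J _ y∈

    cover-least : ∀ {V} → (∀ w → w ∈ J → P A w V) → cover ⊆ V
    cover-least sat = covered⇒∈ sat ∘ Equivalence.to ∈cover⇔

  Sat-cover : ∀ {J₊ J₋ V} → Sat A J₊ J₋ V → Sat A J₊ J₋ (cover J₊)
  Sat-cover {J₊} (sat₊ , sat₋) = P-cover J₊ , λ w w∈J₋ → sat₋ w w∈J₋ ∘ P-mono w (cover-least J₊ sat₊)

lemma2 : (r k : ℕ) .{{_ : NonZero r}} → Coprime r k → 1 ≤ k → 3 * k < r →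
    (A : Subset r) → [ 0 ]ᵣ ∈ A → [ k ]ᵣ ∈ A → (∀ x → x ∈ A → x ∈[0, k ]) →
    (J₊ J₋ : Subset r) (u : Fin r) → u ∉ J₊ → u ∉ J₋ →
    Consistent A J₊ J₋ →
    (¬ ConsistentWith¬ A J₊ J₋ u) ⇔
    (∀ x → x ∈+ u [ A ] → Σ (Fin r) λ w → w ∈ J₊ × x ∈+ w [ A ])
lemma2 r k _ _ _ A _ _ _ J₊ J₋ u _ _ (_ , sat) = mk⇔ inconsistent⇒covered covered⇒inconsistent
  where
  inconsistent⇒covered : ¬ ConsistentWith¬ A J₊ J₋ u → ∀ x → x ∈+ u [ A ] → Covered A J₊ x
  inconsistent⇒covered inconsistent x x∈ with covered? A J₊ x
  ... | yes covered = covered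
  ... | no uncovered = ⊥-elim
    (inconsistent (cover A J₊ , Sat-cover A sat , λ p → uncovered (Equivalence.to (∈cover⇔ A J₊) (p x x∈))))

  covered⇒inconsistent : (∀ x → x ∈+ u [ A ] → Covered A J₊ x) → ¬ ConsistentWith¬ A J₊ J₋ u
  covered⇒inconsistent covered (W , (sat₊ , _) , ¬Pu) = ¬Pu λ x x∈ → covered⇒∈ A J₊ sat₊ (covered x x∈)
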